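{- Let $\varphi$ be a first-order sentence in the language of graphs (with the binary edge relation symbol $E$ and equality) that is a Boolean combination of universal sentences. Then there is a query algorithm for the class $\mathcal C(\varphi)$ of all graphs that are models of $\varphi$.
   Context: Graphs are finite, simple, undirected, with non-empty vertex set; all classes of graphs are closed under isomorphism. A first-order formula is universal if it is built from atomic formulas ($x=y$, $Exy$) and negated atomic formulas using only $\wedge$, $\vee$ and universal quantifiers. For graphs $F,G$, $\hom(F,G)$ is the number of homomorphisms from $F$ to $G$ (maps $V(F)\to V(G)$ sending edges to edges); $\mathrm{emb}(F,G)$ the number of injective homomorphisms; $\mathrm{s\text{ - }hom}(F,G)$ the number of strong homomorphisms (maps with $uv\in E(F)\iff f(u)f(v)\in E(G)$); $\mathrm{s\text{ - }emb}(F,G)$ the number of injective strong homomorphisms. A class $\mathcal C$ has a hom algorithm if there are $k\ge1$, graphs $F_1,\dots,F_k$ and a set $X\subseteq\mathbb N^k$ such that for every graph $G$: $G\in\mathcal C\iff(\hom(F_1,G),\dots,\hom(F_k,G))\in X$. Emb, s-hom and s-emb algorithms are defined in the same way with $\hom$ replaced by $\mathrm{emb}$, $\mathrm{s\text{ - }hom}$, $\mathrm{s\text{ - }emb}$. A class has a query algorithm if it has an algorithm of one (equivalently, each) of these four types. -}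

module Defs where

open import Data.Nat using (ℕ; zero; suc; _≤_)
open import Data.Fin using (Fin; _≟_)
open import Data.Fin.Base using () renaming (zero to fzero; suc to fsuc)
open import Data.Bool using (Bool; true; false; _∧_; _∨_; not; if_then_else_)
open import Data.List using (List; []; _∷_; map; concatMap; filter; length; allFin)
open import Data.Vec using (Vec; lookup) renaming ([] to []ᵥ; _∷_ to _∷ᵥ_)
import Data.Vec as Vec
open import Data.Product using (Σ; _×_)
open import Relation.Nullary using (¬_; does)
open import Relation.Binary.PropositionalEquality using (_≡_)
open import Function.Bundles using (_⇔_)
open import Level using (Level) renaming (suc to lsuc; zero to lzero)

record Graph : Set where
  field
    V        : ℕ
    nonempty : 1 ≤ V
    adj      : Fin V → Fin V → Bool
    adj-sym  : ∀ u v → adj u v ≡ adj v u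
    adj-irr  : ∀ u → adj u u ≡ false
open Graph public

allMaps : (m n : ℕ) → List (Vec (Fin n) m)
allMaps zero    n = []ᵥ ∷ []
allMaps (suc m) n = concatMap (λ i → map (i ∷ᵥ_) (allMaps m n)) (allFin n)

allB : {A : Set} → (A → Bool) → List A → Bool
allB p []       = true
allB p (x ∷ xs) = p x ∧ allB p xs

allPairs : {m : ℕ} → (Fin m → Fin m → Bool) → Bool
allPairs {m} p = allB (λ u → allB (λ v → p u v) (allFin m)) (allFin m)

_≡ᵇ_ : {n : ℕ} → Fin n → Fin n → Bool
i ≡ᵇ j = does (i ≟ j)

_⇒ᵇ_ : Bool → Bool → Bool
a ⇒ᵇ b = not a ∨ b

_⇔ᵇ_ : Bool → Bool → Bool
a ⇔ᵇ b = (a ⇒ᵇ b) ∧ (b ⇒ᵇ a)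

isHom : (F G : Graph) → Vec (Fin (V G)) (V F) → Bool
isHom F G f = allPairs (λ u v → adj F u v ⇒ᵇ adj G (lookup f u) (lookup f v))

isSHom : (F G : Graph) → Vec (Fin (V G)) (V F) → Bool
isSHom F G f = allPairs (λ u v → adj F u v ⇔ᵇ adj G (lookup f u) (lookup f v))

isInj : {m n : ℕ} → Vec (Fin n) m → Bool
isInj f = allPairs (λ u v → (lookup f u ≡ᵇ lookup f v) ⇒ᵇ (u ≡ᵇ v))

countMaps : (F G : Graph) → (Vec (Fin (V G)) (V F) → Bool) → ℕ
countMaps F G p = length (filter (λ f → p f ≟ᵇ true) (allMaps (V F) (V G)))
  where
    open import Data.Bool.Properties using () renaming (_≟_ to _≟ᵇ_)

hom emb s-hom s-emb : Graph → Graph → ℕ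
hom   F G = countMaps F G (isHom F G)
emb   F G = countMaps F G (λ f → isHom F G f ∧ isInj f)
s-hom F G = countMaps F G (isSHom F G)
s-emb F G = countMaps F G (λ f → isSHom F G f ∧ isInj f)

-- First-order logic of graphs (de Bruijn variables; Formula n has
-- free variables among Fin n; sentences are Formula 0).

data Formula : ℕ → Set where
  _≐_  : {n : ℕ} → Fin n → Fin n → Formula n
  E    : {n : ℕ} → Fin n → Fin n → Formula n
  ¬'_  : {n : ℕ} → Formula n → Formula n
  _∧'_ : {n : ℕ} → Formula n → Formula n → Formula n
  _∨'_ : {n : ℕ} → Formula n → Formula n → Formula n
  ∀'_  : {n : ℕ} → Formula (suc n) → Formula n
  ∃'_  : {n : ℕ} → Formula (suc n) → Formula n

Sentence : Set
Sentence = Formula 0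

Sat : (G : Graph) {n : ℕ} → Formula n → Vec (Fin (V G)) n → Set
Sat G (i ≐ j)   ρ = lookup ρ i ≡ lookup ρ j
Sat G (E i j)   ρ = adj G (lookup ρ i) (lookup ρ j) ≡ true
Sat G (¬' φ)    ρ = ¬ Sat G φ ρ
Sat G (φ ∧' ψ)  ρ = Sat G φ ρ × Sat G ψ ρ
Sat G (φ ∨' ψ)  ρ = Data.Sum._⊎_ (Sat G φ ρ) (Sat G ψ ρ)
  where import Data.Sum
Sat G (∀' φ)    ρ = (v : Fin (V G)) → Sat G φ (v ∷ᵥ ρ)
Sat G (∃' φ)    ρ = Σ (Fin (V G)) (λ v → Sat G φ (v ∷ᵥ ρ))

_⊨_ : Graph → Sentence → Set
G ⊨ φ = Sat G φ []ᵥ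

data Universal : {n : ℕ} → Formula n → Set where
  u-eq    : {n : ℕ} (i j : Fin n) → Universal (i ≐ j)
  u-E     : {n : ℕ} (i j : Fin n) → Universal (E i j)
  u-neq   : {n : ℕ} (i j : Fin n) → Universal (¬' (i ≐ j))
  u-nE    : {n : ℕ} (i j : Fin n) → Universal (¬' (E i j))
  u-and   : {n : ℕ} {φ ψ : Formula n} → Universal φ → Universal ψ → Universal (φ ∧' ψ)
  u-or    : {n : ℕ} {φ ψ : Formula n} → Universal φ → Universal ψ → Universal (φ ∨' ψ)
  u-all   : {n : ℕ} {φ : Formula (suc n)} → Universal φ → Universal (∀' φ)

data BoolCombUniv : Sentence → Set where
  bc-univ : {φ : Sentence} → Universal φ → BoolCombUniv φ
  bc-not  : {φ : Sentence} → BoolCombUniv φ → BoolCombUniv (¬' φ)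
  bc-and  : {φ ψ : Sentence} → BoolCombUniv φ → BoolCombUniv ψ → BoolCombUniv (φ ∧' ψ)
  bc-or   : {φ ψ : Sentence} → BoolCombUniv φ → BoolCombUniv ψ → BoolCombUniv (φ ∨' ψ)

Class : Set₁
Class = Graph → Set

HasAlgorithm : (Graph → Graph → ℕ) → Class → Set₁
HasAlgorithm cnt C =
  Σ ℕ λ k → (1 ≤ k) × Σ (Vec Graph k) λ Fs → Σ (Vec ℕ k → Set) λ X →
    (G : Graph) → C G ⇔ X (Vec.map (λ F → cnt F G) Fs)

HasHomAlgorithm HasEmbAlgorithm HasSHomAlgorithm HasSEmbAlgorithm : Class → Set₁
HasHomAlgorithm  = HasAlgorithm hom
HasEmbAlgorithm  = HasAlgorithm emb
HasSHomAlgorithm = HasAlgorithm s-hom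
HasSEmbAlgorithm = HasAlgorithm s-emb

HasQueryAlgorithm : Class → Set₁
HasQueryAlgorithm C =
  Data.Sum._⊎_ (HasHomAlgorithm C)
    (Data.Sum._⊎_ (HasEmbAlgorithm C)
      (Data.Sum._⊎_ (HasSHomAlgorithm C) (HasSEmbAlgorithm C)))
  where import Data.Sum

ModelClass : Sentence → Class
ModelClass φ G = G ⊨ φ

-- A universal sentence ψ fails in G only because of at most (quantifiers ψ) witnesses for its
-- universal quantifiers; the subgraph they induce already refutes ψ, while universal sentences
-- pass from G to its induced subgraphs.  So G ⊨ ψ is decided by which graphs with at most
-- quantifiers ψ + 1 vertices embed strongly into G, and those are exactly the F with
-- s-emb F G > 0.  Boolean combinations inherit this, so the vector of s-emb counts over all
-- small graphs determines membership in C(φ).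
module Submission where

open import Defs
import Data.Nat as ℕ
open import Data.Nat using (ℕ; zero; suc; _≤_; _<_; _+_; z≤n; s≤s)
open import Data.Nat.Properties using (≤-refl; ≤-trans; ≤-reflexive; m≤m+n; m≤n+m; +-mono-≤; ≤∧≢⇒<)
open import Data.Fin using (Fin; _≟_; fromℕ<)
open import Data.Fin.Properties using (all?; any?; ¬∀⟶∃¬)
open import Data.Bool using (Bool; true; false; _∧_; not)
open import Data.Bool.Properties using (∧-comm; ∧-idem) renaming (_≟_ to _≟ᵇ_)
open import Data.List using (List; []; _∷_; _++_; length; map; concatMap; filter; deduplicate)
import Data.List as List
open import Data.List.Properties using (length-++; length-deduplicate; filter-some)
open import Data.List.Membership.Propositional using (_∈_; lose)
open import Data.List.Membership.Propositional.Properties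
  using (∈-++⁺ˡ; ∈-++⁺ʳ; ∈-map⁺; ∈-concatMap⁺; ∈-allFin; ∈-lookup; ∈-deduplicate⁺; ∈-filter⁻)
open import Data.List.Relation.Unary.All using (All; []; _∷_)
import Data.List.Relation.Unary.All as All
open import Data.List.Relation.Unary.All.Properties using (tabulate⁺; tabulate⁻)
open import Data.List.Relation.Unary.Any using (here; there; index)
open import Data.List.Relation.Unary.Any.Properties using (lookup-index)
open import Data.List.Relation.Unary.AllPairs using (_∷_)
open import Data.List.Relation.Unary.Unique.Propositional using (Unique)
open import Data.List.Relation.Unary.Unique.DecPropositional.Properties using (deduplicate-!)
open import Data.Vec using (Vec; lookup; tabulate) renaming ([] to []ᵥ; _∷_ to _∷ᵥ_)
import Data.Vec as Vec
open import Data.Vec.Properties using (lookup-map; lookup∘tabulate; ∷-injectiveˡ; ∷-injectiveʳ)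
open import Data.Product using (Σ; ∃; _×_; _,_; proj₁; proj₂)
open import Data.Product.Function.NonDependent.Propositional using (_×-⇔_)
open import Data.Sum using (inj₁; inj₂)
open import Data.Sum.Function.Propositional using (_⊎-⇔_)
open import Function.Base using (_∘_)
open import Function.Bundles using (_⇔_; mk⇔; Equivalence)
open import Function.Definitions using (Injective)
open import Function.Related.TypeIsomorphisms using (¬-cong-⇔)
open import Relation.Nullary using (¬_; Dec; yes; no; contradiction; _×-dec_; _⊎-dec_; ¬?)
open import Relation.Nullary.Decidable using (dec-true; does-⇔; decidable-stable)
open import Relation.Binary.PropositionalEquality using (_≡_; refl; sym; trans; cong; cong₂; subst)

open Equivalence using (to; from)

Sat? : (G : Graph) {n : ℕ} (φ : Formula n) (ρ : Vec (Fin (V G)) n) → Dec (Sat G φ ρ)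
Sat? G (i ≐ j)  ρ = lookup ρ i ≟ lookup ρ j
Sat? G (E i j)  ρ = adj G (lookup ρ i) (lookup ρ j) ≟ᵇ true
Sat? G (¬' φ)   ρ = ¬? (Sat? G φ ρ)
Sat? G (φ ∧' ψ) ρ = Sat? G φ ρ ×-dec Sat? G ψ ρ
Sat? G (φ ∨' ψ) ρ = Sat? G φ ρ ⊎-dec Sat? G ψ ρ
Sat? G (∀' φ)   ρ = all? λ v → Sat? G φ (v ∷ᵥ ρ)
Sat? G (∃' φ)   ρ = any? λ v → Sat? G φ (v ∷ᵥ ρ)

record StrongEmbedding (H G : Graph) : Set where
  field
    embed     : Fin (V H) → Fin (V G)
    injective : Injective _≡_ _≡_ embed
    adj-embed : ∀ u v → adj H u v ≡ adj G (embed u) (embed v)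
open StrongEmbedding

module _ {H G : Graph} (e : StrongEmbedding H G) where

  private
    lookup-embed : ∀ {n} (σ : Vec (Fin (V H)) n) i → lookup (Vec.map (embed e) σ) i ≡ embed e (lookup σ i)
    lookup-embed σ i = lookup-map i (embed e) σ

  ≐-embed : ∀ {n} (σ : Vec (Fin (V H)) n) i j → Sat H (i ≐ j) σ ⇔ Sat G (i ≐ j) (Vec.map (embed e) σ)
  ≐-embed σ i j = mk⇔
    (λ eq → trans (lookup-embed σ i) (trans (cong (embed e) eq) (sym (lookup-embed σ j))))
    (λ eq → injective e (trans (sym (lookup-embed σ i)) (trans eq (lookup-embed σ j))))

  E-embed : ∀ {n} (σ : Vec (Fin (V H)) n) i j → Sat H (E i j) σ ⇔ Sat G (E i j) (Vec.map (embed e) σ)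
  E-embed σ i j = mk⇔ (trans (sym adj≡)) (trans adj≡)
    where
    adj≡ : adj H (lookup σ i) (lookup σ j)
         ≡ adj G (lookup (Vec.map (embed e) σ) i) (lookup (Vec.map (embed e) σ) j)
    adj≡ = trans (adj-embed e _ _) (sym (cong₂ (adj G) (lookup-embed σ i) (lookup-embed σ j)))

  Universal-reflect : ∀ {n} {ψ : Formula n} → Universal ψ → (σ : Vec (Fin (V H)) n) →
                      Sat G ψ (Vec.map (embed e) σ) → Sat H ψ σ
  Universal-reflect (u-eq i j)  σ = from (≐-embed σ i j)
  Universal-reflect (u-E i j)   σ = from (E-embed σ i j)
  Universal-reflect (u-neq i j) σ = from (¬-cong-⇔ (≐-embed σ i j))
  Universal-reflect (u-nE i j)  σ = from (¬-cong-⇔ (E-embed σ i j))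
  Universal-reflect (u-and p q) σ (a , b) = Universal-reflect p σ a , Universal-reflect q σ b
  Universal-reflect (u-or p q)  σ (inj₁ a) = inj₁ (Universal-reflect p σ a)
  Universal-reflect (u-or p q)  σ (inj₂ b) = inj₂ (Universal-reflect q σ b)
  Universal-reflect (u-all p)   σ s u = Universal-reflect p (u ∷ᵥ σ) (s (embed e u))

quantifiers : ∀ {n} → Formula n → ℕ
quantifiers (i ≐ j)  = 0
quantifiers (E i j)  = 0
quantifiers (¬' φ)   = quantifiers φ
quantifiers (φ ∧' ψ) = quantifiers φ + quantifiers ψ
quantifiers (φ ∨' ψ) = quantifiers φ + quantifiers ψ
quantifiers (∀' φ)   = suc (quantifiers φ)
quantifiers (∃' φ)   = suc (quantifiers φ)

_Hits_ : ∀ {H G} → StrongEmbedding H G → List (Fin (V G)) → Set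
e Hits W = ∀ {w} → w ∈ W → ∃ λ u → embed e u ≡ w

-- W collects one refuting vertex for each universal quantifier on the failing branch.
Universal-refutation : ∀ {G n} {ψ : Formula n} → Universal ψ → (ρ : Vec (Fin (V G)) n) → ¬ Sat G ψ ρ →
  Σ (List (Fin (V G))) λ W → length W ≤ quantifiers ψ ×
    (∀ {H} (e : StrongEmbedding H G) σ → Vec.map (embed e) σ ≡ ρ → e Hits W → ¬ Sat H ψ σ)
Universal-refutation {G} {ψ = ψ} (u-eq i j) ρ ¬sat =
  [] , z≤n , λ e σ eq _ → ¬sat ∘ subst (Sat G ψ) eq ∘ to (≐-embed e σ i j)
Universal-refutation {G} {ψ = ψ} (u-E i j) ρ ¬sat =
  [] , z≤n , λ e σ eq _ → ¬sat ∘ subst (Sat G ψ) eq ∘ to (E-embed e σ i j)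
Universal-refutation {G} {ψ = ψ} (u-neq i j) ρ ¬sat =
  [] , z≤n , λ e σ eq _ → ¬sat ∘ subst (Sat G ψ) eq ∘ to (¬-cong-⇔ (≐-embed e σ i j))
Universal-refutation {G} {ψ = ψ} (u-nE i j) ρ ¬sat =
  [] , z≤n , λ e σ eq _ → ¬sat ∘ subst (Sat G ψ) eq ∘ to (¬-cong-⇔ (E-embed e σ i j))
Universal-refutation {G} (u-and {φ = φ} p q) ρ ¬sat with Sat? G φ ρ
... | no ¬a =
  let W , ∣W∣ , refute = Universal-refutation p ρ ¬a
  in W , ≤-trans ∣W∣ (m≤m+n _ _) , λ e σ eq hits → refute e σ eq hits ∘ proj₁
... | yes a =
  let W , ∣W∣ , refute = Universal-refutation q ρ (¬sat ∘ (a ,_))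
  in W , ≤-trans ∣W∣ (m≤n+m _ _) , λ e σ eq hits → refute e σ eq hits ∘ proj₂
Universal-refutation (u-or p q) ρ ¬sat =
  let W₁ , ∣W₁∣ , refute₁ = Universal-refutation p ρ (¬sat ∘ inj₁)
      W₂ , ∣W₂∣ , refute₂ = Universal-refutation q ρ (¬sat ∘ inj₂)
  in W₁ ++ W₂ , ≤-trans (≤-reflexive (length-++ W₁)) (+-mono-≤ ∣W₁∣ ∣W₂∣) ,
     λ { e σ eq hits (inj₁ a) → refute₁ e σ eq (hits ∘ ∈-++⁺ˡ) a
       ; e σ eq hits (inj₂ b) → refute₂ e σ eq (hits ∘ ∈-++⁺ʳ W₁) b }
Universal-refutation {G} (u-all {φ = φ} p) ρ ¬sat =
  let v , ¬φv = ¬∀⟶∃¬ (V G) (λ v → Sat G φ (v ∷ᵥ ρ)) (λ v → Sat? G φ (v ∷ᵥ ρ)) ¬sat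
      W , ∣W∣ , refute = Universal-refutation p (v ∷ᵥ ρ) ¬φv
  in v ∷ W , s≤s ∣W∣ , λ e σ eq hits s →
       let u , eu≡v = hits (here refl)
       in refute e (u ∷ᵥ σ) (cong₂ _∷ᵥ_ eu≡v eq) (hits ∘ there) (s u)

vectorsOver : ∀ {A : Set} → List A → (n : ℕ) → List (Vec A n)
vectorsOver xs zero    = []ᵥ ∷ []
vectorsOver xs (suc n) = concatMap (λ x → map (x ∷ᵥ_) (vectorsOver xs n)) xs

∈-vectorsOver : ∀ {A : Set} {xs : List A} → (∀ x → x ∈ xs) → ∀ {n} (v : Vec A n) → v ∈ vectorsOver xs n
∈-vectorsOver all []ᵥ       = here refl
∈-vectorsOver all (x ∷ᵥ v) = ∈-concatMap⁺ _ (lose (all x) (∈-map⁺ (x ∷ᵥ_) (∈-vectorsOver all v)))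

∈-allMaps : ∀ {m n} (f : Vec (Fin n) m) → f ∈ allMaps m n
∈-allMaps []ᵥ       = here refl
∈-allMaps (i ∷ᵥ f) = ∈-concatMap⁺ _ (lose (∈-allFin i) (∈-map⁺ (i ∷ᵥ_) (∈-allMaps f)))

-- Symmetrising and clearing the diagonal turns every code into a simple graph.
Code : ℕ → Set
Code m = Vec (Vec Bool m) m

entry : ∀ {m} → Code m → Fin m → Fin m → Bool
entry c u v = lookup (lookup c u) v

codeAdj : ∀ {m} → Code m → Fin m → Fin m → Bool
codeAdj c u v = not (u ≡ᵇ v) ∧ (entry c u v ∧ entry c v u)

fromCode : ∀ {m} → Code (suc m) → Graph
fromCode {m} c = record
  { V        = suc m
  ; nonempty = s≤s z≤n
  ; adj      = codeAdj c
  ; adj-sym  = λ u v → cong₂ (λ a b → not a ∧ b)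
                 (does-⇔ (mk⇔ sym sym) (u ≟ v) (v ≟ u)) (∧-comm (entry c u v) (entry c v u))
  ; adj-irr  = λ u → cong (λ a → not a ∧ (entry c u u ∧ entry c u u)) (dec-true (u ≟ u) refl)
  }

graphsUpTo : ℕ → List Graph
graphsUpTo zero    = []
graphsUpTo (suc q) = map fromCode (vectorsOver (vectorsOver (true ∷ false ∷ []) (suc q)) (suc q)) ++ graphsUpTo q

fromCode-∈ : ∀ {q m} (c : Code (suc m)) → m < q → fromCode c ∈ graphsUpTo q
fromCode-∈ {suc q} {m} c (s≤s m≤q) with m ℕ.≟ q
... | yes refl = ∈-++⁺ˡ (∈-map⁺ fromCode (∈-vectorsOver (∈-vectorsOver bool) c))
  where
  bool : ∀ b → b ∈ true ∷ false ∷ []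
  bool true  = here refl
  bool false = there (here refl)
... | no m≢q  = ∈-++⁺ʳ _ (fromCode-∈ c (≤∧≢⇒< m≤q m≢q))

induced : (G : Graph) {m : ℕ} → (Fin (suc m) → Fin (V G)) → Graph
induced G g = fromCode (tabulate λ u → tabulate λ v → adj G (g u) (g v))

induced-∈ : (G : Graph) {m q : ℕ} (g : Fin (suc m) → Fin (V G)) → m < q → induced G g ∈ graphsUpTo q
induced-∈ G g = fromCode-∈ (tabulate λ u → tabulate λ v → adj G (g u) (g v))

induced-adj : (G : Graph) {m : ℕ} (g : Fin (suc m) → Fin (V G)) →
              ∀ u v → adj (induced G g) u v ≡ adj G (g u) (g v)
induced-adj G g u v
  rewrite lookup∘tabulate (λ u → tabulate λ v → adj G (g u) (g v)) u
        | lookup∘tabulate (λ u → tabulate λ v → adj G (g u) (g v)) v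
        | lookup∘tabulate (λ v → adj G (g u) (g v)) v
        | lookup∘tabulate (λ u → adj G (g v) (g u)) u
        | adj-sym G (g v) (g u)
        with u ≟ v
... | yes refl = sym (adj-irr G (g u))
... | no _     = ∧-idem _

induced-embedding : (G : Graph) {m : ℕ} (g : Fin (suc m) → Fin (V G)) → Injective _≡_ _≡_ g →
                    StrongEmbedding (induced G g) G
induced-embedding G g g-inj = record { embed = g ; injective = g-inj ; adj-embed = induced-adj G g }

Unique-lookup-injective : ∀ {A : Set} {xs : List A} → Unique xs → Injective _≡_ _≡_ (List.lookup xs)
Unique-lookup-injective (_   ∷ _)  {Fin.zero}  {Fin.zero}  _  = refl
Unique-lookup-injective (x≢ ∷ _)  {Fin.zero}  {Fin.suc j} eq = contradiction eq (All.lookup x≢ (∈-lookup j))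
Unique-lookup-injective (x≢ ∷ _)  {Fin.suc i} {Fin.zero}  eq = contradiction (sym eq) (All.lookup x≢ (∈-lookup i))
Unique-lookup-injective (_ ∷ uxs) {Fin.suc i} {Fin.suc j} eq = cong Fin.suc (Unique-lookup-injective uxs eq)

-- The vertex v keeps the spanned graph non-empty.
spanned : (G : Graph) (v : Fin (V G)) (W : List (Fin (V G))) {q : ℕ} → length W < q →
  Σ Graph λ F → F ∈ graphsUpTo q × Σ (StrongEmbedding F G) λ e → e Hits W
spanned G v W ∣W∣<q = induced G g , induced-∈ G g (≤-trans (length-deduplicate _≟_ (v ∷ W)) ∣W∣<q) ,
  induced-embedding G g (Unique-lookup-injective (deduplicate-! _≟_ (v ∷ W))) ,
  λ w∈W → let w∈D = ∈-deduplicate⁺ _≟_ (there w∈W) in index w∈D , sym (lookup-index w∈D)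
  where
  g = List.lookup (deduplicate _≟_ (v ∷ W))

refutable-by-small : ∀ {G q} {ψ : Sentence} → Universal ψ → quantifiers ψ < q → ¬ G ⊨ ψ →
  Σ Graph λ F → F ∈ graphsUpTo q × StrongEmbedding F G × ¬ F ⊨ ψ
refutable-by-small {G} u bound ¬ψ =
  let W , ∣W∣ , refute = Universal-refutation u []ᵥ ¬ψ
      F , F∈ , e , hits = spanned G (fromℕ< (nonempty G)) W (≤-trans (s≤s ∣W∣) bound)
  in F , F∈ , e , refute e []ᵥ refl hits

Universal-transfer : ∀ {G G' q} {ψ : Sentence} → Universal ψ → quantifiers ψ < q →
  (∀ {F} → F ∈ graphsUpTo q → StrongEmbedding F G' → StrongEmbedding F G) → G ⊨ ψ → G' ⊨ ψ
Universal-transfer {G' = G'} {ψ = ψ} u bound sub Gψ = decidable-stable (Sat? G' ψ []ᵥ) λ ¬G'ψ →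
  let F , F∈ , e , ¬Fψ = refutable-by-small u bound ¬G'ψ
  in ¬Fψ (Universal-reflect (sub F∈ e) u []ᵥ Gψ)

SameSmallSubgraphs : ℕ → Graph → Graph → Set
SameSmallSubgraphs q G G' = ∀ {F} → F ∈ graphsUpTo q → StrongEmbedding F G ⇔ StrongEmbedding F G'

BoolCombUniv-invariant : ∀ {G G' q} {φ : Sentence} → BoolCombUniv φ → quantifiers φ < q →
  SameSmallSubgraphs q G G' → G ⊨ φ ⇔ G' ⊨ φ
BoolCombUniv-invariant (bc-univ u) bound same =
  mk⇔ (Universal-transfer u bound (from ∘ same)) (Universal-transfer u bound (to ∘ same))
BoolCombUniv-invariant (bc-not p) bound same = ¬-cong-⇔ (BoolCombUniv-invariant p bound same)
BoolCombUniv-invariant (bc-and p r) bound same =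
  BoolCombUniv-invariant p (≤-trans (s≤s (m≤m+n _ _)) bound) same
    ×-⇔ BoolCombUniv-invariant r (≤-trans (s≤s (m≤n+m _ _)) bound) same
BoolCombUniv-invariant (bc-or p r) bound same =
  BoolCombUniv-invariant p (≤-trans (s≤s (m≤m+n _ _)) bound) same
    ⊎-⇔ BoolCombUniv-invariant r (≤-trans (s≤s (m≤n+m _ _)) bound) same

∧-true : ∀ {a b} → a ∧ b ≡ true ⇔ (a ≡ true × b ≡ true)
∧-true {true}  {true}  = mk⇔ (λ _ → refl , refl) (λ _ → refl)
∧-true {true}  {false} = mk⇔ (λ ()) (λ ())
∧-true {false} {b}     = mk⇔ (λ ()) (λ ())

⇔ᵇ-true : ∀ {a b} → (a ⇔ᵇ b) ≡ true ⇔ a ≡ b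
⇔ᵇ-true {true}  {true}  = mk⇔ (λ _ → refl) (λ _ → refl)
⇔ᵇ-true {true}  {false} = mk⇔ (λ ()) (λ ())
⇔ᵇ-true {false} {true}  = mk⇔ (λ ()) (λ ())
⇔ᵇ-true {false} {false} = mk⇔ (λ _ → refl) (λ _ → refl)

⇒ᵇ-true : ∀ {a b} → (a ⇒ᵇ b) ≡ true ⇔ (a ≡ true → b ≡ true)
⇒ᵇ-true {true}  {b}     = mk⇔ (λ b≡ _ → b≡) (λ f → f refl)
⇒ᵇ-true {false} {true}  = mk⇔ (λ _ _ → refl) (λ _ → refl)
⇒ᵇ-true {false} {false} = mk⇔ (λ _ ()) (λ _ → refl)

≡ᵇ-true : ∀ {n} {u v : Fin n} → (u ≡ᵇ v) ≡ true ⇔ u ≡ v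
≡ᵇ-true {u = u} {v} with u ≟ v
... | yes u≡v = mk⇔ (λ _ → u≡v) (λ _ → refl)
... | no  u≢v = mk⇔ (λ ()) (λ u≡v → contradiction u≡v u≢v)

allB-true : ∀ {A : Set} {p : A → Bool} {xs : List A} → allB p xs ≡ true ⇔ All (λ x → p x ≡ true) xs
allB-true {xs = []}     = mk⇔ (λ _ → []) (λ _ → refl)
allB-true {xs = x ∷ xs} = mk⇔
  (λ h → let px , pxs = to ∧-true h in px ∷ to allB-true pxs)
  (λ { (px ∷ pxs) → from ∧-true (px , from allB-true pxs) })

allPairs-true : ∀ {m} (p : Fin m → Fin m → Bool) → allPairs p ≡ true ⇔ (∀ u v → p u v ≡ true)
allPairs-true p = mk⇔
  (λ h u v → tabulate⁻ (to allB-true (tabulate⁻ (to allB-true h) u)) v)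
  (λ h → from allB-true (tabulate⁺ λ u → from allB-true (tabulate⁺ (h u))))

isSHom-true : (F G : Graph) (f : Vec (Fin (V G)) (V F)) →
              isSHom F G f ≡ true ⇔ (∀ u v → adj F u v ≡ adj G (lookup f u) (lookup f v))
isSHom-true F G f = mk⇔ (λ h u v → to ⇔ᵇ-true (to (allPairs-true p) h u v))
                        (λ h → from (allPairs-true p) λ u v → from ⇔ᵇ-true (h u v))
  where p = λ u v → adj F u v ⇔ᵇ adj G (lookup f u) (lookup f v)

isInj-true : ∀ {m n} (f : Vec (Fin n) m) → isInj f ≡ true ⇔ Injective _≡_ _≡_ (lookup f)
isInj-true f = mk⇔
  (λ h {u} {v} eq → to ≡ᵇ-true (to ⇒ᵇ-true (to (allPairs-true p) h u v) (from ≡ᵇ-true eq)))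
  (λ h → from (allPairs-true p) λ u v → from ⇒ᵇ-true (from ≡ᵇ-true ∘ h ∘ to ≡ᵇ-true))
  where p = λ u v → (lookup f u ≡ᵇ lookup f v) ⇒ᵇ (u ≡ᵇ v)

0<length⇒∈ : ∀ {A : Set} {xs : List A} → 0 < length xs → ∃ (_∈ xs)
0<length⇒∈ {xs = x ∷ _} _ = x , here refl

StrongEmbedding⇔0<s-emb : ∀ {F G} → StrongEmbedding F G ⇔ 0 < s-emb F G
StrongEmbedding⇔0<s-emb {F} {G} = mk⇔
  (λ e → filter-some check? {xs = maps} (lose (∈-allMaps (tabulate (embed e))) (from ∧-true (tabulate-checks e))))
  (λ positive →
     let f , f∈ = 0<length⇒∈ {xs = filter check? maps} positive
         isSHom , isInj = to ∧-true (proj₂ (∈-filter⁻ check? {xs = maps} f∈))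
     in record { embed = lookup f ; injective = to (isInj-true f) isInj ; adj-embed = to (isSHom-true F G f) isSHom })
  where
  maps = allMaps (V F) (V G)
  check? = λ f → (isSHom F G f ∧ isInj f) ≟ᵇ true

  tabulate-checks : (e : StrongEmbedding F G) →
                    isSHom F G (tabulate (embed e)) ≡ true × isInj (tabulate (embed e)) ≡ true
  tabulate-checks e =
    from (isSHom-true F G f) (λ u v → trans (adj-embed e u v) (sym (cong₂ (adj G) (lookup-f u) (lookup-f v)))) ,
    from (isInj-true f) (λ {u} {v} eq → injective e (trans (sym (lookup-f u)) (trans eq (lookup-f v))))
    where
    f = tabulate (embed e)
    lookup-f = lookup∘tabulate (embed e)

s-emb-SameSmallSubgraphs : ∀ {q G G'} → (∀ {F} → F ∈ graphsUpTo q → s-emb F G ≡ s-emb F G') →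
                           SameSmallSubgraphs q G G'
s-emb-SameSmallSubgraphs same {F} F∈ = mk⇔
  (from StrongEmbedding⇔0<s-emb ∘ subst (0 <_) (same F∈) ∘ to StrongEmbedding⇔0<s-emb)
  (from StrongEmbedding⇔0<s-emb ∘ subst (0 <_) (sym (same F∈)) ∘ to StrongEmbedding⇔0<s-emb)

map-fromList-≡ : ∀ {A B : Set} {f g : A → B} (xs : List A) →
                 Vec.map f (Vec.fromList xs) ≡ Vec.map g (Vec.fromList xs) → ∀ {x} → x ∈ xs → f x ≡ g x
map-fromList-≡ (_ ∷ _)  eq (here refl) = ∷-injectiveˡ eq
map-fromList-≡ (_ ∷ xs) eq (there x∈) = map-fromList-≡ xs (∷-injectiveʳ eq) x∈

count-invariant⇒HasAlgorithm : ∀ {C : Class} (cnt : Graph → Graph → ℕ) (Fs : List Graph) → 0 < length Fs →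
  (∀ {G G'} → (∀ {F} → F ∈ Fs → cnt F G ≡ cnt F G') → C G → C G') → HasAlgorithm cnt C
count-invariant⇒HasAlgorithm {C} cnt Fs 0<∣Fs∣ invariant =
  length Fs , 0<∣Fs∣ , Vec.fromList Fs , X , λ G → mk⇔ (λ CG → G , refl , CG) λ (G' , same , CG') →
    invariant (map-fromList-≡ Fs same) CG'
  where
  X : Vec ℕ (length Fs) → Set
  X v = ∃ λ G → Vec.map (λ F → cnt F G) (Vec.fromList Fs) ≡ v × C G

-- K₁ only makes the list of test graphs visibly non-empty; its count is never inspected.
K₁ : Graph
K₁ = record { V = 1 ; nonempty = s≤s z≤n ; adj = λ _ _ → false ; adj-sym = λ _ _ → refl ; adj-irr = λ _ → refl }

theorem4p4 : (φ : Sentence) → BoolCombUniv φ → HasQueryAlgorithm (ModelClass φ)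
theorem4p4 φ bc = inj₂ (inj₂ (inj₂ (count-invariant⇒HasAlgorithm s-emb (K₁ ∷ graphsUpTo q) (s≤s z≤n)
  λ same → to (BoolCombUniv-invariant bc ≤-refl (s-emb-SameSmallSubgraphs {q} (same ∘ there))))))
  where
  q = suc (quantifiers φ)
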